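{- Let $m,n$ be relatively prime positive integers, and let $w\in\widetilde{\mathfrak{S}}_n$ be dominant with $w^{ -1}\in\mathcal{S}_m^n$. Let $w(i)$ ($1\le i\le n$) be a removable $m$-minimal element of $w$. Add $n$ to $w(i)$ in the list $[w(1),\ldots,w(n)]$, subtract $1$ from every entry, and sort the result increasingly. Then the resulting list is the short one-line notation of a dominant affine permutation $w'$ with $w'^{ -1}\in\mathcal{S}_m^n$.
   Context: $\widetilde{\mathfrak{S}}_n$ is the group of bijections $w:\mathbb{Z}\to\mathbb{Z}$ with $w(i+n)=w(i)+n$ and $\sum_{i=1}^n w(i)=\binom{n+1}{2}$; its short one-line notation is $[w(1),\ldots,w(n)]$; $w$ is dominant if $w(1)<\cdots<w(n)$. $w^{ -1}\in\mathcal{S}_m^n$ means $w^{ -1}$ labels an alcove of the Sommers region (the region bounded by the $n$ affine hyperplanes of height $m$), equivalently $w(i)-w(j)\ne m$ for all integers $i<j$. An $m$-minimal element of $w$ is an element of $\{w(i):i\in\mathbb{N}\}$ that is minimal in this set among elements of its residue class modulo $m$; it is removable if it equals $w(i)$ for some $1\le i\le n$. -}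

module Defs where

open import Data.Nat as ℕ using (ℕ; zero; suc; _≡ᵇ_)
open import Data.Nat.Combinatorics using (_C_)
open import Data.Integer as ℤ using (ℤ; +_; _-_; _<_; _≤_)
open import Data.Integer.Divisibility using (_∣_)
open import Data.Integer.Properties using (≤-decTotalOrder)
open import Data.List using (List; map; upTo; foldr)
open import Data.Bool using (if_then_else_)
open import Data.Product using (_×_; ∃)
open import Relation.Binary.PropositionalEquality using (_≡_; _≢_)
open import Function.Definitions using (Bijective)
import Data.List.Sort

record AffPerm (n : ℕ) : Set where
  field
    fun        : ℤ → ℤ
    bijective  : Bijective _≡_ _≡_ fun
    periodic   : ∀ (i : ℤ) → fun (i ℤ.+ + n) ≡ fun i ℤ.+ + n
    window-sum : foldr ℤ._+_ (+ 0) (map (λ k → fun (+ suc k)) (upTo n)) ≡ + (suc n C 2)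

open AffPerm public

window : ∀ {n} → AffPerm n → List ℤ
window {n} w = map (λ k → fun w (+ suc k)) (upTo n)

Dominant : ∀ {n} → AffPerm n → Set
Dominant {n} w = ∀ (i j : ℕ) → 1 ℕ.≤ i → i ℕ.< j → j ℕ.≤ n → fun w (+ i) < fun w (+ j)

-- w^{-1} ∈ S_m^n, via the stated equivalent condition: w(i) - w(j) ≠ m for all integers i < j
InvInSommers : ∀ {n} (m : ℕ) → AffPerm n → Set
InvInSommers m w = ∀ (i j : ℤ) → i < j → fun w i - fun w j ≢ + m

MMinimal : ∀ {n} (m : ℕ) → AffPerm n → ℤ → Set
MMinimal m w v =
  ∃ (λ (i : ℕ) → 1 ℕ.≤ i × fun w (+ i) ≡ v)
  × (∀ (j : ℕ) → 1 ℕ.≤ j → (+ m) ∣ (fun w (+ j) - v) → v ≤ fun w (+ j))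

Removable : ∀ {n} (m : ℕ) → AffPerm n → ℤ → Set
Removable {n} m w v = MMinimal m w v × ∃ (λ (i : ℕ) → 1 ℕ.≤ i × i ℕ.≤ n × fun w (+ i) ≡ v)

sortℤ : List ℤ → List ℤ
sortℤ = Data.List.Sort.sort ≤-decTotalOrder

modifiedWindow : ∀ {n} → AffPerm n → ℕ → List ℤ
modifiedWindow {n} w i =
  map (λ k → (fun w (+ suc k) ℤ.+ (if suc k ≡ᵇ i then + n else + 0)) - + 1) (upTo n)

-- Every integer is uniquely pos r q = r + 1 + q·n with r : Fin n.  Adding n to w(i) in the
-- window amounts to reading w one level higher in the residue class of i, so the modified
-- window consists of the values w(pos k (raise k)) − 1.  Sorting it permutes the classes,
-- hence the periodic extension w′ of the sorted window is x ↦ w(τ x) − 1 for a bijection τ of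
-- ℤ that permutes the classes and lifts class i by one level: w′ is an affine permutation, and
-- it is dominant because its window is sorted.  If w′(p) − w′(q) = m with p < q, then
-- w(τ p) − w(τ q) = m, which the Sommers condition for w forbids as long as τ p < τ q.  On a
-- single level w′ increases, so the difference is negative.  Across levels the order can only
-- flip when τ p lies in class i and τ q in a class k′ on the same level; for k′ > i the order
-- is kept after all, and for k′ < i the equation w(i) − w(k′) = m would make w(k′) < w(i)
-- congruent to w(i) modulo m, contradicting m-minimality.

module Submission where

open import Defs
open import Data.Nat as ℕ using (ℕ; zero; suc; NonZero; z≤n; s≤s; _≤_)
import Data.Nat.Properties as ℕP
open import Data.Nat.Coprimality using (Coprime)
open import Data.Nat.Combinatorics using (_C_)
open import Data.Integer as ℤ using (ℤ; +_; _+_; _-_; _*_; -_; _<_; +<+; +≤+)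
import Data.Integer.Properties as ℤP
open import Data.Integer.DivMod using (_/ℕ_; _%ℕ_; a≡a%ℕn+[a/ℕn]*n; n%ℕd<d)
import Data.Nat.Divisibility as ℕD
open import Data.Integer.Solver using (module +-*-Solver)
open import Algebra.Properties.AbelianGroup ℤP.+-0-abelianGroup using (∙-cancelʳ; //-rightDividesˡ)
open import Data.Fin as Fin using (Fin; toℕ; fromℕ<; cast)
import Data.Fin.Properties as FinP
open import Data.Fin.Permutation using (Permutation′; _⟨$⟩ʳ_; _⟨$⟩ˡ_; _∘ₚ_; cast-id; inverseʳ)
open import Data.Bool using (true; false; T; if_then_else_)
open import Data.Unit using (tt)
open import Data.List using (List; length; map; upTo; tabulate; lookup; applyUpTo; foldr; _∷_)
open import Data.List.Properties using (map-upTo; tabulate-cong; tabulate-lookup; length-tabulate; lookup-tabulate)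
open import Data.List.Relation.Binary.Permutation.Propositional using (_↭_; ↭⇒↭ₛ)
open import Data.List.Relation.Binary.Permutation.Propositional.Properties using (↭-length)
import Data.List.Relation.Binary.Permutation.Setoid as SetoidPermutation
import Data.List.Relation.Binary.Permutation.Setoid.Properties as SetoidPermutationProperties
open import Data.List.Relation.Unary.Sorted.TotalOrder ℤP.≤-totalOrder using (Sorted)
open import Data.List.Relation.Unary.Sorted.TotalOrder.Properties using (lookup-mono-≤)
open import Data.List.Sort ℤP.≤-decTotalOrder using (sort-↭; sort-↗)
open import Data.Product using (Σ; ∃; _×_; _,_; proj₁; proj₂)
open import Data.Sum using (_⊎_; inj₁; inj₂)
open import Data.Empty using (⊥-elim)
open import Function using (_∘_)
open import Function.Definitions using (Injective; Bijective)
open import Function.Bundles using (Injection)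
open import Function.Properties.Inverse using (↔⇒↣)
open import Function.Consequences.Propositional using (strictlySurjective⇒surjective)
open import Relation.Nullary using (yes; no)
open import Relation.Binary.Definitions using (tri<; tri≈; tri>)
open import Relation.Binary.PropositionalEquality
open +-*-Solver

module _ {a} {A : Set a} where
  open SetoidPermutation (setoid A) using (onIndices)
  open SetoidPermutationProperties (setoid A) using (onIndices-lookup)

  applyUpTo≡tabulate : ∀ (f : ℕ → A) n → applyUpTo f n ≡ tabulate (λ (k : Fin n) → f (toℕ k))
  applyUpTo≡tabulate f zero = refl
  applyUpTo≡tabulate f (suc n) = cong (f 0 ∷_) (applyUpTo≡tabulate (f ∘ suc) n)

  tabulate-lookup-cast : ∀ {n} (xs : List A) (e : length xs ≡ n) → tabulate (lookup xs ∘ cast (sym e)) ≡ xs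
  tabulate-lookup-cast xs refl = trans (tabulate-cong (cong (lookup xs) ∘ FinP.cast-is-id refl)) (tabulate-lookup xs)

  lookup-tabulate-cast : ∀ {n} (f : Fin n → A) i → lookup (tabulate f) i ≡ f (cast (length-tabulate f) i)
  lookup-tabulate-cast f i = trans
    (cong (lookup (tabulate f)) (sym (FinP.cast-involutive (sym (length-tabulate f)) (length-tabulate f) i)))
    (lookup-tabulate f (cast (length-tabulate f) i))

  ↭-tabulate : ∀ {n} {xs : List A} (f : Fin n → A) → xs ↭ tabulate f →
               ∃ λ (π : Permutation′ n) → xs ≡ tabulate (f ∘ (π ⟨$⟩ʳ_))
  ↭-tabulate {n} {xs} f xs↭ = π , (begin
      xs                                        ≡⟨ tabulate-lookup-cast xs |xs|≡n ⟨
      tabulate (lookup xs ∘ cast (sym |xs|≡n))  ≡⟨ tabulate-cong lookup-π ⟩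
      tabulate (f ∘ (π ⟨$⟩ʳ_))                  ∎)
    where
    open ≡-Reasoning
    ρ = onIndices (↭⇒↭ₛ xs↭)
    |xs|≡n = trans (↭-length xs↭) (length-tabulate f)
    π : Permutation′ n
    π = cast-id (sym |xs|≡n) ∘ₚ ρ ∘ₚ cast-id (length-tabulate f)
    lookup-π : ∀ r → lookup xs (cast (sym |xs|≡n) r) ≡ f (π ⟨$⟩ʳ r)
    lookup-π r = trans (onIndices-lookup (↭⇒↭ₛ xs↭) _) (lookup-tabulate-cast f _)

tabulate-sorted⇒monotone : ∀ {n} {g : Fin n → ℤ} → Sorted (tabulate g) → ∀ {r s} → r Fin.≤ s → g r ℤ.≤ g s
tabulate-sorted⇒monotone {g = g} g↗ {r} {s} r≤s = subst₂ ℤ._≤_ (lookup-tabulate g r) (lookup-tabulate g s)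
  (lookup-mono-≤ ℤP.≤-totalOrder g↗ (subst₂ _≤_ (sym (FinP.toℕ-cast _ r)) (sym (FinP.toℕ-cast _ s)) r≤s))

tabulate-sorted⇒strictlyMonotone : ∀ {n} {g : Fin n → ℤ} → Sorted (tabulate g) → Injective _≡_ _≡_ g →
                                   ∀ {r s} → r Fin.< s → g r < g s
tabulate-sorted⇒strictlyMonotone g↗ g-injective r<s =
  ℤP.≤∧≢⇒< (tabulate-sorted⇒monotone g↗ (ℕP.<⇒≤ r<s))
           (λ gr≡gs → ℕP.<-irrefl (cong toℕ (g-injective gr≡gs)) r<s)

sumℤ : List ℤ → ℤ
sumℤ = foldr _+_ (+ 0)

sumℤ-↭ : ∀ {xs ys} → xs ↭ ys → sumℤ xs ≡ sumℤ ys
sumℤ-↭ xs↭ys = foldr-commMonoid ℤP.+-0-isCommutativeMonoid (↭⇒↭ₛ xs↭ys)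
  where open SetoidPermutationProperties (setoid ℤ) using (foldr-commMonoid)

sumℤ-tabulate-+ : ∀ {n} (f g : Fin n → ℤ) →
                  sumℤ (tabulate (λ k → f k + g k)) ≡ sumℤ (tabulate f) + sumℤ (tabulate g)
sumℤ-tabulate-+ {zero} f g = refl
sumℤ-tabulate-+ {suc n} f g = trans
  (cong (λ t → f Fin.zero + g Fin.zero + t) (sumℤ-tabulate-+ (f ∘ Fin.suc) (g ∘ Fin.suc)))
  (solve 4 (λ a b s t → a :+ b :+ (s :+ t) := a :+ s :+ (b :+ t)) refl (f Fin.zero) (g Fin.zero) _ _)

sumℤ-tabulate-const : ∀ n c → sumℤ (tabulate {n = n} (λ _ → c)) ≡ + n * c
sumℤ-tabulate-const zero c = refl
sumℤ-tabulate-const (suc n) c = trans (cong (λ t → c + t) (sumℤ-tabulate-const n c)) (sym (ℤP.suc-* (+ n) c))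

sumℤ-tabulate-indicator : ∀ {n} (i : Fin n) c →
  sumℤ (tabulate (λ (k : Fin n) → if toℕ k ℕ.≡ᵇ toℕ i then c else + 0)) ≡ c
sumℤ-tabulate-indicator {suc n} Fin.zero c = begin
  c + sumℤ (tabulate {n = n} (λ _ → + 0)) ≡⟨ cong (λ t → c + t) (sumℤ-tabulate-const n (+ 0)) ⟩
  c + + n * + 0                          ≡⟨ cong (λ t → c + t) (ℤP.*-zeroʳ (+ n)) ⟩
  c + + 0                                ≡⟨ ℤP.+-identityʳ c ⟩
  c                                      ∎
  where open ≡-Reasoning
sumℤ-tabulate-indicator {suc n} (Fin.suc i) c =
  trans (ℤP.+-identityˡ (sumℤ (tabulate (λ (k : Fin n) → if toℕ k ℕ.≡ᵇ toℕ i then c else + 0))))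
        (sumℤ-tabulate-indicator i c)

[i+k]-[j+k]≡i-j : ∀ i j k → (i + k) - (j + k) ≡ i - j
[i+k]-[j+k]≡i-j = solve 3 (λ i j k → i :+ k :- (j :+ k) := i :- j) refl

i<j⇒i-j≢+ : ∀ {i j} m → i < j → i - j ≢ + m
i<j⇒i-j≢+ {i} {j} m i<j i-j≡m = ℤP.<⇒≱ i<j (begin
  j              ≤⟨ ℤP.i≤j+i j (+ m) ⟩
  + m + j        ≡⟨ cong (_+ j) i-j≡m ⟨
  i - j + j      ≡⟨ //-rightDividesˡ j i ⟩
  i              ∎)
  where open ℤP.≤-Reasoning

module _ (n : ℕ) .{{_ : NonZero n}} where

  pos : Fin n → ℤ → ℤ
  pos r q = + suc (toℕ r) + q * + n

  pos-zero : ∀ r → pos r (+ 0) ≡ + suc (toℕ r)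
  pos-zero r = ℤP.+-identityʳ (+ suc (toℕ r))

  pos-suc : ∀ r q → pos r q + + n ≡ pos r (q + + 1)
  pos-suc r q = solve 3 (λ x q n → x :+ q :* n :+ n := x :+ (q :+ con (+ 1)) :* n) refl (+ suc (toℕ r)) q (+ n)

  pos-monoˡ-< : ∀ {r r' q q'} → q < q' → pos r q < pos r' q'
  pos-monoˡ-< {r} {r'} {q} {q'} q<q' = begin-strict
    + suc (toℕ r) + q * + n  ≤⟨ ℤP.+-monoˡ-≤ (q * + n) (+≤+ (FinP.toℕ<n r)) ⟩
    + n + q * + n           ≡⟨ ℤP.suc-* q (+ n) ⟨
    (+ 1 + q) * + n         ≤⟨ ℤP.*-monoʳ-≤-nonNeg (+ n) (ℤP.i<j⇒suc[i]≤j q<q') ⟩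
    q' * + n                ≡⟨ ℤP.+-identityˡ (q' * + n) ⟨
    + 0 + q' * + n          <⟨ ℤP.+-monoˡ-< (q' * + n) (+<+ (ℕ.s≤s ℕ.z≤n)) ⟩
    pos r' q'               ∎
    where open ℤP.≤-Reasoning

  pos-monoʳ-< : ∀ q {r r'} → r Fin.< r' → pos r q < pos r' q
  pos-monoʳ-< q r<r' = ℤP.+-monoˡ-< (q * + n) (+<+ (ℕ.s≤s r<r'))

  pos-<⁻¹ : ∀ r q r' q' → pos r q < pos r' q' → q < q' ⊎ (q ≡ q' × r Fin.< r')
  pos-<⁻¹ r q r' q' p<p' with ℤP.<-cmp q q'
  ... | tri< q<q' _ _ = inj₁ q<q'
  ... | tri> _ _ q>q' = ⊥-elim (ℤP.<-asym p<p' (pos-monoˡ-< q>q'))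
  ... | tri≈ _ refl _ with FinP.<-cmp r r'
  ...   | tri< r<r' _ _ = inj₂ (refl , r<r')
  ...   | tri≈ _ refl _ = ⊥-elim (ℤP.<-irrefl refl p<p')
  ...   | tri> _ _ r>r' = ⊥-elim (ℤP.<-asym p<p' (pos-monoʳ-< q r>r'))

  pos-injective : ∀ r q r' q' → pos r q ≡ pos r' q' → r ≡ r' × q ≡ q'
  pos-injective r q r' q' p≡p' with ℤP.<-cmp q q'
  ... | tri< q<q' _ _ = ⊥-elim (ℤP.<-irrefl p≡p' (pos-monoˡ-< q<q'))
  ... | tri> _ _ q>q' = ⊥-elim (ℤP.<-irrefl (sym p≡p') (pos-monoˡ-< q>q'))
  ... | tri≈ _ refl _ with FinP.<-cmp r r'
  ...   | tri< r<r' _ _ = ⊥-elim (ℤP.<-irrefl p≡p' (pos-monoʳ-< q r<r'))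
  ...   | tri≈ _ r≡r' _ = r≡r' , refl
  ...   | tri> _ _ r>r' = ⊥-elim (ℤP.<-irrefl (sym p≡p') (pos-monoʳ-< q r>r'))

  residue : ℤ → Fin n
  residue x = fromℕ< (n%ℕd<d (x - + 1) n)

  quotient : ℤ → ℤ
  quotient x = (x - + 1) /ℕ n

  pos-residue-quotient : ∀ x → pos (residue x) (quotient x) ≡ x
  pos-residue-quotient x = begin
    + suc (toℕ (residue x)) + quotient x * + n   ≡⟨ cong (λ k → + suc k + quotient x * + n) (FinP.toℕ-fromℕ< _) ⟩
    + suc ((x - + 1) %ℕ n) + quotient x * + n     ≡⟨ ℤP.+-assoc (+ 1) (+ ((x - + 1) %ℕ n)) (quotient x * + n) ⟩
    + 1 + (+ ((x - + 1) %ℕ n) + quotient x * + n) ≡⟨ cong (λ y → + 1 + y) (a≡a%ℕn+[a/ℕn]*n (x - + 1) n) ⟨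
    + 1 + (x - + 1)                               ≡⟨ solve 1 (λ x → con (+ 1) :+ (x :- con (+ 1)) := x) refl x ⟩
    x                                             ∎
    where open ≡-Reasoning

  pos-elim : (P : ℤ → Set) → (∀ r q → P (pos r q)) → ∀ x → P x
  pos-elim P h x = subst P (pos-residue-quotient x) (h (residue x) (quotient x))

  pos-elim₂ : (P : ℤ → ℤ → Set) → (∀ r q r' q' → P (pos r q) (pos r' q')) → ∀ x y → P x y
  pos-elim₂ P h x y = pos-elim (λ x → P x y) (λ r q → pos-elim (P (pos r q)) (h r q) y) x

  Periodic : (ℤ → ℤ) → Set
  Periodic f = ∀ x → f (x + + n) ≡ f x + + n

  module _ (f : ℤ → ℤ) (f-periodic : Periodic f) where

    periodic-+ : ∀ x k → f (x + + k * + n) ≡ f x + + k * + n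
    periodic-+ x zero = trans (cong f (ℤP.+-identityʳ x)) (sym (ℤP.+-identityʳ (f x)))
    periodic-+ x (suc k) = begin
      f (x + + suc k * + n)   ≡⟨ cong f (step x) ⟩
      f (x + + k * + n + + n) ≡⟨ f-periodic _ ⟩
      f (x + + k * + n) + + n ≡⟨ cong (_+ + n) (periodic-+ x k) ⟩
      f x + + k * + n + + n   ≡⟨ step (f x) ⟨
      f x + + suc k * + n     ∎
      where
      open ≡-Reasoning
      step : ∀ y → y + + suc k * + n ≡ y + + k * + n + + n
      step y = solve 3 (λ y k n → y :+ (con (+ 1) :+ k) :* n := y :+ k :* n :+ n) refl y (+ k) (+ n)

    periodic-* : ∀ x q → f (x + q * + n) ≡ f x + q * + n
    periodic-* x (+ k) = periodic-+ x k
    periodic-* x q@(ℤ.-[1+ k ]) = begin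
      f y                               ≡⟨ solve 2 (λ a b → a := a :+ b :- b) refl (f y) (+ suc k * + n) ⟩
      f y + + suc k * + n - + suc k * + n ≡⟨ cong (_- + suc k * + n) (periodic-+ y (suc k)) ⟨
      f (y + + suc k * + n) - + suc k * + n ≡⟨ cong (λ z → f z - + suc k * + n) y+[1+k]n≡x ⟩
      f x - + suc k * + n               ≡⟨ solve 3 (λ a k n → a :- k :* n := a :+ (:- k) :* n)
                                                   refl (f x) (+ suc k) (+ n) ⟩
      f x + q * + n                     ∎
      where
      open ≡-Reasoning
      y = x + q * + n
      y+[1+k]n≡x : y + + suc k * + n ≡ x
      y+[1+k]n≡x = solve 3 (λ x k n → x :+ (:- k) :* n :+ k :* n := x) refl x (+ suc k) (+ n)

  extend : (Fin n → ℤ) → ℤ → ℤ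
  extend g x = g (residue x) + quotient x * + n

  module _ (g : Fin n → ℤ) where

    extend-pos : ∀ r q → extend g (pos r q) ≡ g r + q * + n
    extend-pos r q with pos-injective (residue (pos r q)) (quotient (pos r q)) r q (pos-residue-quotient (pos r q))
    ... | r≡ , q≡ = cong₂ (λ s t → g s + t * + n) r≡ q≡

    extend-periodic : Periodic (extend g)
    extend-periodic x = begin
      extend g (x + + n)                     ≡⟨ cong (λ y → extend g (y + + n)) (pos-residue-quotient x) ⟨
      extend g (pos r q + + n)               ≡⟨ cong (extend g) (pos-suc r q) ⟩
      extend g (pos r (q + + 1))             ≡⟨ extend-pos r (q + + 1) ⟩
      g r + (q + + 1) * + n                  ≡⟨ solve 3 (λ a q n → a :+ (q :+ con (+ 1)) :* n := a :+ q :* n :+ n)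
                                                        refl (g r) q (+ n) ⟩
      g r + q * + n + + n                    ≡⟨ cong (_+ + n) (extend-pos r q) ⟨
      extend g (pos r q) + + n               ≡⟨ cong (λ y → extend g y + + n) (pos-residue-quotient x) ⟩
      extend g x + + n                       ∎
      where
      open ≡-Reasoning
      r = residue x
      q = quotient x

  extend-window : ∀ g r → extend g (+ suc (toℕ r)) ≡ g r
  extend-window g r = begin
    extend g (+ suc (toℕ r))  ≡⟨ cong (extend g) (pos-zero r) ⟨
    extend g (pos r (+ 0))    ≡⟨ extend-pos g r (+ 0) ⟩
    g r + + 0                 ≡⟨ ℤP.+-identityʳ (g r) ⟩
    g r                       ∎
    where open ≡-Reasoning

  extend-window-list : ∀ g → map (λ k → extend g (+ suc k)) (upTo n) ≡ tabulate g
  extend-window-list g = trans (map-upTo _ n)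
    (trans (applyUpTo≡tabulate _ n) (tabulate-cong (extend-window g)))

  extend-injective⇒injective : ∀ {g} → Injective _≡_ _≡_ (extend g) → Injective _≡_ _≡_ g
  extend-injective⇒injective {g} inj {r} {s} gr≡gs =
    proj₁ (pos-injective r (+ 0) s (+ 0) (inj {pos r (+ 0)} {pos s (+ 0)} extend-r≡extend-s))
    where
    open ≡-Reasoning
    extend-r≡extend-s : extend g (pos r (+ 0)) ≡ extend g (pos s (+ 0))
    extend-r≡extend-s = begin
      extend g (pos r (+ 0))  ≡⟨ extend-pos g r (+ 0) ⟩
      g r + + 0               ≡⟨ cong (_+ + 0) gr≡gs ⟩
      g s + + 0               ≡⟨ extend-pos g s (+ 0) ⟨
      extend g (pos s (+ 0))  ∎

  module _ (f : ℤ → ℤ) (f-periodic : Periodic f) (π : Permutation′ n) (d : Fin n → ℤ) (c : ℤ) where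

    shuffledWindow : Fin n → ℤ
    shuffledWindow r = f (pos (π ⟨$⟩ʳ r) (d (π ⟨$⟩ʳ r))) + c

    extend-shuffled : ∀ r q → extend shuffledWindow (pos r q) ≡ f (pos (π ⟨$⟩ʳ r) (q + d (π ⟨$⟩ʳ r))) + c
    extend-shuffled r q = begin
      extend shuffledWindow (pos r q)   ≡⟨ extend-pos shuffledWindow r q ⟩
      f (pos k (d k)) + c + q * + n     ≡⟨ solve 3 (λ a c b → a :+ c :+ b := a :+ b :+ c) refl (f (pos k (d k))) c (q * + n) ⟩
      f (pos k (d k)) + q * + n + c     ≡⟨ cong (_+ c) (periodic-* f f-periodic (pos k (d k)) q) ⟨
      f (pos k (d k) + q * + n) + c     ≡⟨ cong (λ x → f x + c) level-shift ⟩
      f (pos k (q + d k)) + c           ∎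
      where
      open ≡-Reasoning
      k = π ⟨$⟩ʳ r
      level-shift : pos k (d k) + q * + n ≡ pos k (q + d k)
      level-shift = solve 4 (λ x d q n → x :+ d :* n :+ q :* n := x :+ (q :+ d) :* n) refl (+ suc (toℕ k)) (d k) q (+ n)

    extend-shuffled-bijective : Bijective _≡_ _≡_ f → Bijective _≡_ _≡_ (extend shuffledWindow)
    extend-shuffled-bijective (f-injective , f-surjective) = injective , strictlySurjective⇒surjective surjective
      where
      F = extend shuffledWindow

      injective-pos : ∀ r q r' q' → F (pos r q) ≡ F (pos r' q') → pos r q ≡ pos r' q'
      injective-pos r q r' q' Fp≡Fp'
        with pos-injective (π ⟨$⟩ʳ r) (q + d (π ⟨$⟩ʳ r)) (π ⟨$⟩ʳ r') (q' + d (π ⟨$⟩ʳ r')) (f-injective f-eq)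
        where
        f-eq : f (pos (π ⟨$⟩ʳ r) (q + d (π ⟨$⟩ʳ r))) ≡ f (pos (π ⟨$⟩ʳ r') (q' + d (π ⟨$⟩ʳ r')))
        f-eq = ∙-cancelʳ c _ _ (trans (sym (extend-shuffled r q)) (trans Fp≡Fp' (extend-shuffled r' q')))
      ... | πr≡πr' , q+d≡q'+d' with Injection.injective (↔⇒↣ π) {r} {r'} πr≡πr'
      ... | refl = cong (pos r) (∙-cancelʳ (d (π ⟨$⟩ʳ r)) q q' q+d≡q'+d')

      injective : Injective _≡_ _≡_ F
      injective {x} {y} = pos-elim₂ (λ x y → F x ≡ F y → x ≡ y) injective-pos x y

      surjective : ∀ y → Σ ℤ λ x → F x ≡ y
      surjective y = pos r (t - d k) , (begin
        F (pos r (t - d k))                             ≡⟨ extend-shuffled r (t - d k) ⟩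
        f (pos (π ⟨$⟩ʳ r) (t - d k + d (π ⟨$⟩ʳ r))) + c  ≡⟨ cong (λ j → f (pos j (t - d k + d j)) + c) (inverseʳ π) ⟩
        f (pos k (t - d k + d k)) + c                   ≡⟨ cong (λ s → f (pos k s) + c) (//-rightDividesˡ (d k) t) ⟩
        f (pos k t) + c                                 ≡⟨ cong (λ x → f x + c) (pos-residue-quotient x₀) ⟩
        f x₀ + c                                        ≡⟨ cong (_+ c) (proj₂ (f-surjective (y - c)) refl) ⟩
        y - c + c                                       ≡⟨ //-rightDividesˡ c y ⟩
        y                                               ∎)
        where
        open ≡-Reasoning
        x₀ = proj₁ (f-surjective (y - c))
        k = residue x₀
        t = quotient x₀
        r = π ⟨$⟩ˡ k

  fromWindow : (g : Fin n → ℤ) → Bijective _≡_ _≡_ (extend g) → sumℤ (tabulate g) ≡ + (suc n C 2) → AffPerm n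
  fromWindow g bijective window-sum = record
    { fun        = extend g
    ; bijective  = bijective
    ; periodic   = extend-periodic g
    ; window-sum = trans (cong sumℤ (extend-window-list g)) window-sum
    }

  fromWindow-dominant : ∀ {g} bij sum → (∀ {r s} → r Fin.< s → g r < g s) → Dominant (fromWindow g bij sum)
  fromWindow-dominant {g} _ _ g-mono (suc i) (suc j) _ (s≤s i<j) j≤n =
    subst₂ _<_ (window-value i (ℕP.<-trans i<j j≤n)) (window-value j j≤n)
      (g-mono (subst₂ ℕ._<_ (sym (FinP.toℕ-fromℕ< _)) (sym (FinP.toℕ-fromℕ< _)) i<j))
    where
    window-value : ∀ k (k<n : k ℕ.< n) → g (fromℕ< k<n) ≡ extend g (+ suc k)
    window-value k k<n = trans (sym (extend-window g (fromℕ< k<n)))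
                               (cong (λ j → extend g (+ suc j)) (FinP.toℕ-fromℕ< k<n))

  module _ (w : AffPerm n) (w-dominant : Dominant w) where

    dominant-window : ∀ {k k' : Fin n} → k Fin.< k' → fun w (+ suc (toℕ k)) < fun w (+ suc (toℕ k'))
    dominant-window {k} {k'} k<k' = w-dominant (suc (toℕ k)) (suc (toℕ k')) (s≤s z≤n) (s≤s k<k') (FinP.toℕ<n k')

    mMinimal-gap : ∀ {m} {i : Fin n} → MMinimal m w (fun w (+ suc (toℕ i))) →
                   ∀ {k : Fin n} → k Fin.< i → fun w (+ suc (toℕ i)) - fun w (+ suc (toℕ k)) ≢ + m
    mMinimal-gap {m} {i} (_ , minimal) {k} k<i gap = ℤP.<⇒≱ (dominant-window k<i)
      (minimal (suc (toℕ k)) (s≤s z≤n) (subst (m ℕD.∣_) ∣gap∣ ℕD.∣-refl))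
      where
      ∣gap∣ : m ≡ ℤ.∣ fun w (+ suc (toℕ k)) - fun w (+ suc (toℕ i)) ∣
      ∣gap∣ = trans (cong ℤ.∣_∣ (sym gap)) (ℤP.∣i-j∣≡∣j-i∣ (fun w (+ suc (toℕ i))) (fun w (+ suc (toℕ k))))

  module _ (w : AffPerm n) (i : Fin n) where

    raise : Fin n → ℤ
    raise k = if toℕ k ℕ.≡ᵇ toℕ i then + 1 else + 0

    raise-view : ∀ k → (k ≡ i × raise k ≡ + 1) ⊎ (k ≢ i × raise k ≡ + 0)
    raise-view k with toℕ k ℕ.≡ᵇ toℕ i in eq
    ... | true  = inj₁ (FinP.toℕ-injective (ℕP.≡ᵇ⇒≡ _ _ (subst T (sym eq) tt)) , refl)
    ... | false = inj₂ ((λ k≡i → subst T eq (ℕP.≡⇒≡ᵇ _ _ (cong toℕ k≡i))) , refl)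

    raise-order : ∀ k k' → raise k ℤ.≤ raise k' ⊎ (k ≡ i × k' ≢ i × raise k ≡ + 1 × raise k' ≡ + 0)
    raise-order k k' with raise-view k | raise-view k'
    ... | inj₁ (k≡i , rk≡1) | inj₂ (k'≢i , rk'≡0) = inj₂ (k≡i , k'≢i , rk≡1 , rk'≡0)
    ... | inj₁ (_ , rk≡1)   | inj₁ (_ , rk'≡1)   = inj₁ (ℤP.≤-reflexive (trans rk≡1 (sym rk'≡1)))
    ... | inj₂ (_ , rk≡0)   | inj₁ (_ , rk'≡1)   = inj₁ (subst₂ ℤ._≤_ (sym rk≡0) (sym rk'≡1) (+≤+ z≤n))
    ... | inj₂ (_ , rk≡0)   | inj₂ (_ , rk'≡0)   = inj₁ (ℤP.≤-reflexive (trans rk≡0 (sym rk'≡0)))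

    modifiedEntry : Fin n → ℤ
    modifiedEntry k = fun w (pos k (raise k)) - + 1

    modifiedWindow-tabulate : modifiedWindow w (suc (toℕ i)) ≡
      tabulate (λ k → (fun w (+ suc (toℕ k)) + (if toℕ k ℕ.≡ᵇ toℕ i then + n else + 0)) - + 1)
    modifiedWindow-tabulate = trans (map-upTo _ n) (applyUpTo≡tabulate _ n)

    raised-value : ∀ k b → fun w (pos k (if b then + 1 else + 0)) ≡ fun w (+ suc (toℕ k)) + (if b then + n else + 0)
    raised-value k true  = trans (cong (λ t → fun w (+ suc (toℕ k) + t)) (ℤP.*-identityˡ (+ n))) (periodic w _)
    raised-value k false = trans (cong (fun w) (pos-zero k)) (sym (ℤP.+-identityʳ _))

    modifiedWindow≡tabulate : modifiedWindow w (suc (toℕ i)) ≡ tabulate modifiedEntry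
    modifiedWindow≡tabulate = trans modifiedWindow-tabulate
      (tabulate-cong (λ k → cong (_- + 1) (sym (raised-value k (toℕ k ℕ.≡ᵇ toℕ i)))))

    sumℤ-modifiedWindow : sumℤ (modifiedWindow w (suc (toℕ i))) ≡ sumℤ (window w)
    sumℤ-modifiedWindow = begin
      sumℤ (modifiedWindow w (suc (toℕ i)))
        ≡⟨ cong sumℤ modifiedWindow-tabulate ⟩
      sumℤ (tabulate (λ k → a k + δ k - + 1))
        ≡⟨ sumℤ-tabulate-+ (λ k → a k + δ k) (λ _ → - + 1) ⟩
      sumℤ (tabulate (λ k → a k + δ k)) + sumℤ (tabulate (λ (_ : Fin n) → - + 1))
        ≡⟨ cong₂ _+_ (sumℤ-tabulate-+ a δ) (sumℤ-tabulate-const n (- + 1)) ⟩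
      sumℤ (tabulate a) + sumℤ (tabulate δ) + + n * - + 1
        ≡⟨ cong (λ t → sumℤ (tabulate a) + t + + n * - + 1) (sumℤ-tabulate-indicator i (+ n)) ⟩
      sumℤ (tabulate a) + + n + + n * - + 1
        ≡⟨ solve 2 (λ s n → s :+ n :+ n :* :- con (+ 1) := s) refl (sumℤ (tabulate a)) (+ n) ⟩
      sumℤ (tabulate a)
        ≡⟨ cong sumℤ (trans (map-upTo _ n) (applyUpTo≡tabulate _ n)) ⟨
      sumℤ (window w)
        ∎
      where
      open ≡-Reasoning
      a δ : Fin n → ℤ
      a k = fun w (+ suc (toℕ k))
      δ k = if toℕ k ℕ.≡ᵇ toℕ i then + n else + 0

    sortedPermutation : ∃ λ (π : Permutation′ n) →
                        sortℤ (modifiedWindow w (suc (toℕ i))) ≡ tabulate (modifiedEntry ∘ (π ⟨$⟩ʳ_))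
    sortedPermutation = ↭-tabulate modifiedEntry
      (subst (sortℤ (modifiedWindow w (suc (toℕ i))) ↭_) modifiedWindow≡tabulate (sort-↭ _))

    π : Permutation′ n
    π = proj₁ sortedPermutation

    newWindow : Fin n → ℤ
    newWindow = shuffledWindow (fun w) (periodic w) π raise (- + 1)

    newWindow-bijective : Bijective _≡_ _≡_ (extend newWindow)
    newWindow-bijective = extend-shuffled-bijective (fun w) (periodic w) π raise (- + 1) (bijective w)

    newWindow-sum : sumℤ (tabulate newWindow) ≡ + (suc n C 2)
    newWindow-sum = begin
      sumℤ (tabulate newWindow)                       ≡⟨ cong sumℤ (proj₂ sortedPermutation) ⟨
      sumℤ (sortℤ (modifiedWindow w (suc (toℕ i))))   ≡⟨ sumℤ-↭ (sort-↭ _) ⟩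
      sumℤ (modifiedWindow w (suc (toℕ i)))           ≡⟨ sumℤ-modifiedWindow ⟩
      sumℤ (window w)                                 ≡⟨ window-sum w ⟩
      + (suc n C 2)                                   ∎
      where open ≡-Reasoning

    newWindow-strictlyMonotone : ∀ {r s} → r Fin.< s → newWindow r < newWindow s
    newWindow-strictlyMonotone = tabulate-sorted⇒strictlyMonotone
      (subst Sorted (proj₂ sortedPermutation) (sort-↗ _))
      (extend-injective⇒injective (proj₁ newWindow-bijective))

    w′ : AffPerm n
    w′ = fromWindow newWindow newWindow-bijective newWindow-sum

    window-w′ : window w′ ≡ sortℤ (modifiedWindow w (suc (toℕ i)))
    window-w′ = trans (extend-window-list newWindow) (sym (proj₂ sortedPermutation))

    w′-dominant : Dominant w′
    w′-dominant = fromWindow-dominant newWindow-bijective newWindow-sum newWindow-strictlyMonotone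

    module _ {m : ℕ} (w-sommers : InvInSommers m w)
             (i-gap : ∀ {k : Fin n} → k Fin.< i → fun w (+ suc (toℕ i)) - fun w (+ suc (toℕ k)) ≢ + m) where

      same-level : ∀ t {k'} → k' ≢ i → fun w (pos i t) - fun w (pos k' t) ≢ + m
      same-level t {k'} k'≢i with FinP.<-cmp i k'
      ... | tri< i<k' _ _ = w-sommers _ _ (pos-monoʳ-< t i<k')
      ... | tri≈ _ i≡k' _ = ⊥-elim (k'≢i (sym i≡k'))
      ... | tri> _ _ k'<i = λ gap → i-gap k'<i (trans (sym level-diff) gap)
        where
        level-diff : fun w (pos i t) - fun w (pos k' t) ≡ fun w (+ suc (toℕ i)) - fun w (+ suc (toℕ k'))
        level-diff = trans (cong₂ _-_ (periodic-* (fun w) (periodic w) _ t) (periodic-* (fun w) (periodic w) _ t))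
          ([i+k]-[j+k]≡i-j (fun w (+ suc (toℕ i))) (fun w (+ suc (toℕ k'))) (t * + n))

      raise-overtake : ∀ k k' {s s'} → s < s' → s' + raise k' ℤ.≤ s + raise k →
                       k ≡ i × k' ≢ i × s + raise k ≡ s' + raise k'
      raise-overtake k k' {s} {s'} s<s' overtake with raise-order k k'
      ... | inj₁ rk≤rk' = ⊥-elim (ℤP.<⇒≱ (ℤP.+-mono-<-≤ s<s' rk≤rk') overtake)
      ... | inj₂ (k≡i , k'≢i , rk≡1 , rk'≡0) = k≡i , k'≢i , ℤP.≤-antisym level≤ overtake
        where
        open ℤP.≤-Reasoning
        level≤ : s + raise k ℤ.≤ s' + raise k'
        level≤ = begin
          s + raise k    ≡⟨ cong (λ e → s + e) rk≡1 ⟩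
          s + + 1        ≡⟨ ℤP.+-comm s (+ 1) ⟩
          + 1 + s        ≤⟨ ℤP.i<j⇒suc[i]≤j s<s' ⟩
          s'             ≡⟨ ℤP.+-identityʳ s' ⟨
          s' + + 0       ≡⟨ cong (λ e → s' + e) rk'≡0 ⟨
          s' + raise k'  ∎

      raised-sommers : ∀ k k' {s s'} → s < s' → fun w (pos k (s + raise k)) - fun w (pos k' (s' + raise k')) ≢ + m
      raised-sommers k k' {s} {s'} s<s' with (s + raise k) ℤP.<? (s' + raise k')
      ... | yes lower = w-sommers _ _ (pos-monoˡ-< lower)
      ... | no not-lower with raise-overtake k k' s<s' (ℤP.≮⇒≥ not-lower)
      ...   | k≡i , k'≢i , level≡ = subst (λ p → fun w p - fun w (pos k' (s' + raise k')) ≢ + m)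
                                          (sym (cong₂ pos k≡i level≡)) (same-level (s' + raise k') k'≢i)

      w′-sommers : InvInSommers m w′
      w′-sommers = pos-elim₂ (λ x y → x < y → extend newWindow x - extend newWindow y ≢ + m) sommers-pos
        where
        sommers-pos : ∀ r s r' s' → pos r s < pos r' s' → extend newWindow (pos r s) - extend newWindow (pos r' s') ≢ + m
        sommers-pos r s r' s' p<p' with pos-<⁻¹ r s r' s' p<p'
        ... | inj₂ (refl , r<r') = i<j⇒i-j≢+ m
          (subst₂ _<_ (sym (extend-pos newWindow r s)) (sym (extend-pos newWindow r' s))
                      (ℤP.+-monoˡ-< (s * + n) (newWindow-strictlyMonotone r<r')))
        ... | inj₁ s<s' = λ gap → raised-sommers (π ⟨$⟩ʳ r) (π ⟨$⟩ʳ r') s<s' (trans (sym unshift) gap)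
          where
          P Q : ℤ
          P = pos (π ⟨$⟩ʳ r) (s + raise (π ⟨$⟩ʳ r))
          Q = pos (π ⟨$⟩ʳ r') (s' + raise (π ⟨$⟩ʳ r'))
          unshift : extend newWindow (pos r s) - extend newWindow (pos r' s') ≡ fun w P - fun w Q
          unshift = trans (cong₂ _-_ (extend-shuffled (fun w) (periodic w) π raise (- + 1) r s)
                                     (extend-shuffled (fun w) (periodic w) π raise (- + 1) r' s'))
                          ([i+k]-[j+k]≡i-j (fun w P) (fun w Q) (- + 1))

lemma6p5 : (m n : ℕ) → 1 ≤ m → 1 ≤ n → Coprime m n →
    (w : AffPerm n) → Dominant w → InvInSommers m w →
    (i : ℕ) → 1 ≤ i → i ≤ n → Removable m w (fun w (+ i)) →
    Σ (AffPerm n) (λ w′ → window w′ ≡ sortℤ (modifiedWindow w i)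
      × Dominant w′ × InvInSommers m w′)
lemma6p5 m n@(suc _) _ _ _ w w-dominant w-sommers (suc i₀) _ i≤n (i-minimal , _)
  with fromℕ< i≤n | FinP.toℕ-fromℕ< i≤n
... | i | refl = w′ n w i , window-w′ n w i , w′-dominant n w i ,
                 w′-sommers n w i w-sommers (mMinimal-gap n w w-dominant {i = i} i-minimal)
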